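{- Let $w \in \mathfrak{S}_n$ and $k \in [1,n-2]$. Then $w$ interlaces $k$ and $k+1$ if and only if the permutation $w^{\langle k\rangle}$ contains a $321$-pattern centered at $k+1$.
   Context: $\mathfrak{S}_n$ is the symmetric group generated by adjacent transpositions $\sigma_i=(i\ i+1)$; permutations are composed right to left and written in one-line notation $w=w(1)w(2)\cdots w(n)$. A reduced word for $w$ is a word $a_1\cdots a_\ell$ with $w=\sigma_{a_1}\cdots\sigma_{a_\ell}$ and $\ell$ minimal. The letters $k$ and $k+1$ are interlaced in $w$ if the reduced words of $w$ contain both $k$ and $k+1$ and some reduced word of $w$ contains a (not necessarily consecutive) subsequence $k,\,k+1,\,k$ or $k+1,\,k,\,k+1$. Construction of $w^{\langle k\rangle}$: set $m := w^{ -1}(k+1)$. (1) If $m=k+1$, then $w^{\langle k\rangle}:=w$. (2) If $m>k+1$ and $w(k+1)>k+1$, or if $m<k+1$ and $w(k+1)<k+1$, then $w^{\langle k\rangle}(i)=w(i)$ for $i\notin\{m,k+1\}$, $w^{\langle k\rangle}(k+1)=k+1$, and $w^{\langle k\rangle}(m)=w(k+1)$. (3) If $m>k+1$ and $w(k+1)<k+1$, let $t$ be the maximal $t<k+1$ with $w(t)>k+1$; if $m<k+1$ and $w(k+1)>k+1$, let $t$ be the minimal $t>k+1$ with $w(t)<k+1$. In either case $w^{\langle k\rangle}(i)=w(i)$ for $i\notin\{m,k+1,t\}$, $w^{\langle k\rangle}(k+1)=k+1$, $w^{\langle k\rangle}(t)=w(k+1)$, and $w^{\langle k\rangle}(m)=w(t)$.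 In all cases $w^{\langle k\rangle}$ fixes $k+1$. If a permutation $u$ fixes $h$, then $u$ has a $321$-pattern centered at $h$ if there exist $i<h<j$ with $u(i)>h>u(j)$ (i.e., a $321$-pattern whose middle entry is the value $h$ in position $h$). -}

module Defs where

open import Data.Nat using (ℕ; zero; suc; _+_; _∸_; _≤_; _<_; _<?_; _≡ᵇ_; _<ᵇ_)
open import Data.Fin using (Fin; toℕ; fromℕ<)
open import Data.Fin.Permutation using (Permutation′; _⟨$⟩ʳ_; flip)
open import Data.List using (List; []; _∷_; length)
open import Data.List.Relation.Unary.All using (All)
open import Data.List.Membership.Propositional using (_∈_)
open import Data.List.Relation.Binary.Sublist.Propositional using (_⊆_)
open import Data.Bool using (Bool; true; false; if_then_else_; _∧_; _∨_)
open import Data.Product using (_×_; ∃-syntax)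
open import Data.Sum using (_⊎_)
open import Relation.Nullary using (yes; no)
open import Relation.Binary.PropositionalEquality using (_≡_)

-- Conventions: positions and values are 1-indexed natural numbers 1..n,
-- as in the paper.  A permutation w ∈ S_n is a Permutation′ n on Fin n,
-- and  fun w : ℕ → ℕ  is its one-line notation  i ↦ w(i)  for 1 ≤ i ≤ n
-- (extended by the identity outside [1,n]).
fun : {n : ℕ} → Permutation′ n → ℕ → ℕ
fun w zero = zero
fun {n} w (suc j) with j <? n
... | yes p = suc (toℕ (w ⟨$⟩ʳ fromℕ< p))
... | no _ = suc j

funInv : {n : ℕ} → Permutation′ n → ℕ → ℕ
funInv w = fun (flip w)

σ : ℕ → ℕ → ℕ
σ a x = if x ≡ᵇ a then suc a else (if x ≡ᵇ suc a then a else x)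

evalWord : List ℕ → ℕ → ℕ
evalWord [] x = x
evalWord (a ∷ as) x = σ a (evalWord as x)

IsWord : {n : ℕ} → Permutation′ n → List ℕ → Set
IsWord {n} w ws =
  All (λ a → 1 ≤ a × a ≤ n ∸ 1) ws ×
  (∀ (i : Fin n) → evalWord ws (suc (toℕ i)) ≡ suc (toℕ (w ⟨$⟩ʳ i)))

IsReduced : {n : ℕ} → Permutation′ n → List ℕ → Set
IsReduced w ws = IsWord w ws × (∀ vs → IsWord w vs → length ws ≤ length vs)

Interlaced : {n : ℕ} → Permutation′ n → ℕ → Set
Interlaced w k =
  (∀ ws → IsReduced w ws → (k ∈ ws × suc k ∈ ws)) ×
  ∃[ ws ] (IsReduced w ws ×
           ((k ∷ suc k ∷ k ∷ []) ⊆ ws ⊎ (suc k ∷ k ∷ suc k ∷ []) ⊆ ws))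

-- largest t with  lo ≤ t ≤ hi  and  f t > b  (0 if none)
maxAbove : (ℕ → ℕ) → ℕ → ℕ → ℕ → ℕ
maxAbove f b lo zero = zero
maxAbove f b lo (suc hi) =
  if (lo <ᵇ suc (suc hi)) ∧ (b <ᵇ f (suc hi)) then suc hi else maxAbove f b lo hi

-- smallest t with  lo ≤ t ≤ lo + len - 1  and  f t < b  (0 if none)
minBelow : (ℕ → ℕ) → ℕ → ℕ → ℕ → ℕ
minBelow f b lo zero = zero
minBelow f b lo (suc len) = if f lo <ᵇ b then lo else minBelow f b (suc lo) len

wAngle : {n : ℕ} → Permutation′ n → ℕ → ℕ → ℕ
wAngle {n} w k i =
  if m ≡ᵇ K then fun w i
  else if case2 then
    (if i ≡ᵇ K then K else if i ≡ᵇ m then a else fun w i)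
  else
    (if i ≡ᵇ K then K else if i ≡ᵇ t then a
     else if i ≡ᵇ m then fun w t else fun w i)
  where
  K = suc k
  m = funInv w K
  a = fun w K
  case2 : Bool
  case2 = ((K <ᵇ m) ∧ (K <ᵇ a)) ∨ ((m <ᵇ K) ∧ (a <ᵇ K))
  t : ℕ
  t = if K <ᵇ m then maxAbove (fun w) K 1 k
      else minBelow (fun w) K (suc K) (n ∸ K)

Has321At : ℕ → (ℕ → ℕ) → ℕ → Set
Has321At n u h = ∃[ i ] ∃[ j ]
  (1 ≤ i × i < h × h < j × j ≤ n × h < u i × u j < h)

-- Interlacing is a Bruhat-order condition: k and k + 1 are interlaced in w
-- exactly when s_k s_{k+1} s_k ≤ w, and by the rank-matrix criterion this
-- says that some position left of K = k + 1 carries a value right of K, and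
-- that two positions ≤ K carry values ≥ K.  These conditions follow from a
-- reduced word containing k, k+1, k (or k+1, k, k+1) by the subword property.
-- Conversely, a reduced word in which every k precedes every k + 1 (or the
-- other way round) would keep all values of [1, k] inside [1, K] (or send at
-- most one position of [1, K] to a value ≥ K).  Finally w⟨k⟩ moves at most
-- three values of w so that K becomes fixed; a case analysis, with a
-- pigeonhole argument producing a small value right of K, shows that the two
-- conditions hold exactly when w⟨k⟩ has a 321-pattern centred at K.
module Submission where

open import Defs
open import Data.Bool using (Bool; true; false; if_then_else_; T; _∧_; _∨_)
open import Data.Empty using (⊥; ⊥-elim)
open import Data.Fin using (Fin; toℕ; fromℕ<) renaming (zero to fzero; suc to fsuc)
open import Data.Fin.Permutation using (Permutation′; _⟨$⟩ʳ_; _⟨$⟩ˡ_; flip; inverseˡ; inverseʳ)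
import Data.Fin.Permutation.Components as PC
open import Data.Fin.Permutation.Transposition.List using (TranspositionList; eval; decompose; eval-decompose)
open import Data.Fin.Properties using (toℕ-fromℕ<; fromℕ<-toℕ; toℕ<n; toℕ-injective; all?; pigeonhole)
  renaming (_≟_ to _≟ᶠ_)
open import Data.List using (List; []; _∷_; _++_; length)
open import Data.List.Membership.Propositional using (_∈_; _∉_)
open import Data.List.Membership.Propositional.Properties using (∈-++⁻)
open import Data.List.Properties using (length-++; ++-assoc; ++-identityʳ)
open import Data.List.Relation.Binary.Sublist.Propositional using (_⊆_; []; _∷_; _∷ʳ_; ⊆-refl; from∈)
open import Data.List.Relation.Binary.Sublist.Propositional.Properties using (++⁺; ++⁺ʳ; All-resp-⊆)
open import Data.List.Relation.Unary.All using (All; []; _∷_) renaming (map to All-map)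
open import Data.List.Relation.Unary.All.Properties using () renaming (++⁺ to ++⁺ᴬ)
open import Data.List.Relation.Unary.Any using (here; there)
open import Data.List.Reverse using (Reverse; []; _∶_∶ʳ_; reverseView)
open import Data.Nat
open import Data.Nat.Properties
open import Algebra.Properties.CommutativeSemigroup +-commutativeSemigroup using (interchange)
open import Data.List.Membership.DecPropositional _≟_ using (_∈?_)
open import Data.Product using (_×_; _,_; proj₁; proj₂; ∃-syntax)
open import Data.Sum using (_⊎_; inj₁; inj₂; [_,_]′)
open import Data.Unit using (⊤; tt)
open import Function using (_∘_)
open import Function.Bundles using (_⇔_; mk⇔)
open import Function.Definitions using (Injective)
open import Function.Properties.Equivalence using () renaming (trans to ⇔-trans)
open import Relation.Binary.Definitions using (tri<; tri≈; tri>)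
open import Relation.Binary.PropositionalEquality
open import Relation.Nullary using (¬_; Dec; yes; no)
open import Relation.Nullary.Decidable using (_×-dec_)

T⇒≡true : ∀ {b} → T b → b ≡ true
T⇒≡true {true} _ = refl

¬T⇒≡false : ∀ {b} → ¬ T b → b ≡ false
¬T⇒≡false {false} _ = refl
¬T⇒≡false {true} ¬t = ⊥-elim (¬t _)

≡⇒≡ᵇ-true : ∀ {x y} → x ≡ y → (x ≡ᵇ y) ≡ true
≡⇒≡ᵇ-true {x} {y} x≡y = T⇒≡true (≡⇒≡ᵇ x y x≡y)

≡ᵇ-refl : ∀ x → (x ≡ᵇ x) ≡ true
≡ᵇ-refl x = ≡⇒≡ᵇ-true {x} refl

≢⇒≡ᵇ-false : ∀ {x y} → x ≢ y → (x ≡ᵇ y) ≡ false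
≢⇒≡ᵇ-false {x} {y} x≢y = ¬T⇒≡false (x≢y ∘ ≡ᵇ⇒≡ x y)

<⇒<ᵇ-true : ∀ {x y} → x < y → (x <ᵇ y) ≡ true
<⇒<ᵇ-true = T⇒≡true ∘ <⇒<ᵇ

≮⇒<ᵇ-false : ∀ {x y} → ¬ x < y → (x <ᵇ y) ≡ false
≮⇒<ᵇ-false {x} {y} x≮y = ¬T⇒≡false (x≮y ∘ <ᵇ⇒< x y)

<⇒≤∸1 : ∀ {m n} → m < n → m ≤ n ∸ 1
<⇒≤∸1 {n = suc n} (s≤s m≤n) = m≤n

+suc[∸suc] : ∀ {a b} → a < b → a + suc (b ∸ suc a) ≡ b
+suc[∸suc] {a} {b} a<b = trans (+-suc a (b ∸ suc a)) (m+[n∸m]≡n a<b)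

length-∷ʳ : ∀ (xs : List ℕ) c → length (xs ++ c ∷ []) ≡ suc (length xs)
length-∷ʳ xs c = trans (length-++ xs) (+-comm (length xs) 1)

∉-∷ : ∀ {x y : ℕ} {L} → x ≢ y → x ∉ L → x ∉ y ∷ L
∉-∷ x≢y _ (here x≡y) = x≢y x≡y
∉-∷ _ x∉L (there x∈L) = x∉L x∈L

∉-++ : ∀ {x : ℕ} {xs ys} → x ∉ xs → x ∉ ys → x ∉ xs ++ ys
∉-++ {xs = xs} x∉xs x∉ys x∈ = [ x∉xs , x∉ys ]′ (∈-++⁻ xs x∈)

InRange : ℕ → ℕ → Set
InRange n x = 1 ≤ x × x ≤ n

∃-inRange? : {P : ℕ → Set} → (∀ a → Dec (P a)) → ∀ N → Dec (∃[ a ] (InRange N a × P a))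
∃-inRange? P? zero = no λ { (a , (1≤a , a≤0) , _) → <-irrefl refl (≤-trans 1≤a a≤0) }
∃-inRange? {P} P? (suc N) with P? (suc N) | ∃-inRange? P? N
... | yes p | _ = yes (suc N , (s≤s z≤n , ≤-refl) , p)
... | no _ | yes (a , (1≤a , a≤N) , p) = yes (a , (1≤a , m≤n⇒m≤1+n a≤N) , p)
... | no ¬p | no none = no λ { (a , (1≤a , a≤1+N) , p) → cases a 1≤a a≤1+N p }
  where
  cases : ∀ a → 1 ≤ a → a ≤ suc N → P a → ⊥
  cases a 1≤a a≤1+N p with a ≟ suc N
  ... | yes refl = ¬p p
  ... | no a≢1+N = none (a , (1≤a , ≤-pred (≤∧≢⇒< a≤1+N a≢1+N)) , p)

-- Simple transpositions and words

data SwapView (a x : ℕ) : Set where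
  left : x ≡ a → SwapView a x
  right : x ≡ suc a → SwapView a x
  other : x ≢ a → x ≢ suc a → SwapView a x

swapView : ∀ a x → SwapView a x
swapView a x with x ≟ a | x ≟ suc a
... | yes x≡a | _ = left x≡a
... | no _ | yes x≡1+a = right x≡1+a
... | no x≢a | no x≢1+a = other x≢a x≢1+a

σ-left : ∀ a → σ a a ≡ suc a
σ-left a rewrite ≡ᵇ-refl a = refl

σ-right : ∀ a → σ a (suc a) ≡ a
σ-right a rewrite ≢⇒≡ᵇ-false (>⇒≢ (n<1+n a)) | ≡ᵇ-refl a = refl

σ-other : ∀ a {x} → x ≢ a → x ≢ suc a → σ a x ≡ x
σ-other a x≢a x≢1+a rewrite ≢⇒≡ᵇ-false x≢a | ≢⇒≡ᵇ-false x≢1+a = refl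

σ-involutive : ∀ a x → σ a (σ a x) ≡ x
σ-involutive a x with swapView a x
... | left refl rewrite σ-left a = σ-right a
... | right refl rewrite σ-right a = σ-left a
... | other x≢a x≢1+a rewrite σ-other a x≢a x≢1+a = σ-other a x≢a x≢1+a

σ-injective : ∀ a {x y} → σ a x ≡ σ a y → x ≡ y
σ-injective a {x} {y} eq = begin
  x             ≡⟨ σ-involutive a x ⟨
  σ a (σ a x)   ≡⟨ cong (σ a) eq ⟩
  σ a (σ a y)   ≡⟨ σ-involutive a y ⟩
  y             ∎
  where open ≡-Reasoning

σ-zero : ∀ {a} → 1 ≤ a → σ a 0 ≡ 0
σ-zero {suc a} _ = refl

σ-mono-< : ∀ a {x y} → y < x → ¬ (y ≡ a × x ≡ suc a) → σ a y < σ a x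
σ-mono-< a {x} {y} y<x ¬swapped with swapView a y | swapView a x
... | left refl | left refl = ⊥-elim (<-irrefl refl y<x)
... | left refl | right refl = ⊥-elim (¬swapped (refl , refl))
... | left refl | other x≢a x≢1+a
  rewrite σ-left a | σ-other a x≢a x≢1+a = ≤∧≢⇒< y<x (x≢1+a ∘ sym)
... | right refl | left refl = ⊥-elim (<-asym y<x (n<1+n a))
... | right refl | right refl = ⊥-elim (<-irrefl refl y<x)
... | right refl | other x≢a x≢1+a
  rewrite σ-right a | σ-other a x≢a x≢1+a = <-trans (n<1+n a) y<x
... | other y≢a y≢1+a | left refl
  rewrite σ-left a | σ-other a y≢a y≢1+a = m≤n⇒m≤1+n y<x
... | other y≢a y≢1+a | right refl
  rewrite σ-right a | σ-other a y≢a y≢1+a = ≤∧≢⇒< (≤-pred y<x) y≢a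
... | other y≢a y≢1+a | other x≢a x≢1+a
  rewrite σ-other a y≢a y≢1+a | σ-other a x≢a x≢1+a = y<x

σ-intertwine : ∀ {f b c} → Injective _≡_ _≡_ f → f c ≡ b → f (suc c) ≡ suc b →
  ∀ v → σ b (f v) ≡ f (σ c v)
σ-intertwine {f} {b} {c} inj fc≡b fc+1≡b+1 v with swapView c v
... | left refl rewrite σ-left c | fc≡b | fc+1≡b+1 = σ-left b
... | right refl rewrite σ-right c | fc≡b | fc+1≡b+1 = σ-right b
... | other v≢c v≢1+c rewrite σ-other c v≢c v≢1+c =
  σ-other b (v≢c ∘ inj ∘ (λ e → trans e (sym fc≡b)))
            (v≢1+c ∘ inj ∘ (λ e → trans e (sym fc+1≡b+1)))

evalWord-++ : ∀ xs ys x → evalWord (xs ++ ys) x ≡ evalWord xs (evalWord ys x)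
evalWord-++ [] ys x = refl
evalWord-++ (a ∷ xs) ys x = cong (σ a) (evalWord-++ xs ys x)

evalWord-injective : ∀ ws {x y} → evalWord ws x ≡ evalWord ws y → x ≡ y
evalWord-injective [] eq = eq
evalWord-injective (a ∷ ws) eq = evalWord-injective ws (σ-injective a eq)

evalWord-zero : ∀ {ws} → All (1 ≤_) ws → evalWord ws 0 ≡ 0
evalWord-zero [] = refl
evalWord-zero {a ∷ ws} (1≤a ∷ ps) rewrite evalWord-zero ps = σ-zero 1≤a

evalWord-surjective : ∀ ws y → ∃[ x ] (evalWord ws x ≡ y)
evalWord-surjective [] y = y , refl
evalWord-surjective (a ∷ ws) y with evalWord-surjective ws (σ a y)
... | x , eq = x , trans (cong (σ a) eq) (σ-involutive a y)

τ : ℕ → ℕ → ℕ → ℕ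
τ a b x = if x ≡ᵇ a then b else (if x ≡ᵇ b then a else x)

τ-left : ∀ a b → τ a b a ≡ b
τ-left a b rewrite ≡ᵇ-refl a = refl

τ-right : ∀ a b → τ a b b ≡ a
τ-right a b with b ≟ a
... | yes refl rewrite ≡ᵇ-refl a = refl
... | no b≢a rewrite ≢⇒≡ᵇ-false b≢a | ≡ᵇ-refl b = refl

τ-other : ∀ a b {x} → x ≢ a → x ≢ b → τ a b x ≡ x
τ-other a b x≢a x≢b rewrite ≢⇒≡ᵇ-false x≢a | ≢⇒≡ᵇ-false x≢b = refl

τ-sym : ∀ a b x → τ a b x ≡ τ b a x
τ-sym a b x with x ≟ a | x ≟ b
... | yes refl | yes refl = refl
... | yes refl | no x≢b rewrite τ-left x b = sym (τ-right b x)
... | no x≢a | yes refl rewrite τ-right a x = sym (τ-left x a)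
... | no x≢a | no x≢b rewrite τ-other a b x≢a x≢b = sym (τ-other b a x≢b x≢a)

τ-self : ∀ a x → τ a a x ≡ x
τ-self a x with x ≟ a
... | yes refl = τ-left x x
... | no x≢a = τ-other a a x≢a x≢a

τ-involutive : ∀ a b x → τ a b (τ a b x) ≡ x
τ-involutive a b x with x ≟ a | x ≟ b
... | yes refl | _ rewrite τ-left x b = τ-right x b
... | no _ | yes refl rewrite τ-right a x = τ-left a x
... | no x≢a | no x≢b rewrite τ-other a b x≢a x≢b = τ-other a b x≢a x≢b

τ-inRange : ∀ {n a b x} → InRange n a → InRange n b → InRange n x → InRange n (τ a b x)
τ-inRange {a = a} {b} {x} a-inRange b-inRange x-inRange with x ≟ a | x ≟ b
... | yes refl | _ rewrite τ-left x b = b-inRange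
... | no _ | yes refl rewrite τ-right a x = a-inRange
... | no x≢a | no x≢b rewrite τ-other a b x≢a x≢b = x-inRange

σ-conj-τ : ∀ {a c} → a < c → ∀ x → σ c (τ a c (σ c x)) ≡ τ a (suc c) x
σ-conj-τ {a} {c} a<c x with swapView c x
... | left refl
  rewrite σ-left c | τ-other a c (>⇒≢ (m<n⇒m<1+n a<c)) (>⇒≢ (n<1+n c))
        | σ-right c | τ-other a (suc c) (>⇒≢ a<c) (<⇒≢ (n<1+n c)) = refl
... | right refl
  rewrite σ-right c | τ-right a c | τ-right a (suc c) = σ-other c (<⇒≢ a<c) (<⇒≢ (m<n⇒m<1+n a<c))
... | other x≢c x≢1+c with x ≟ a
...   | yes refl rewrite σ-other c x≢c x≢1+c | τ-left x c | τ-left x (suc c) = σ-left c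
...   | no x≢a rewrite σ-other c x≢c x≢1+c | τ-other a c x≢a x≢c | τ-other a (suc c) x≢a x≢1+c =
  σ-other c x≢c x≢1+c

τWord : ℕ → ℕ → List ℕ
τWord a zero = a ∷ []
τWord a (suc d) = (a + suc d) ∷ (τWord a d ++ (a + suc d) ∷ [])

τWord-eval : ∀ a d x → evalWord (τWord a d) x ≡ τ a (a + suc d) x
τWord-eval a zero x rewrite +-comm a 1 = refl
τWord-eval a (suc d) x = begin
  σ c (evalWord (τWord a d ++ c ∷ []) x)   ≡⟨ cong (σ c) (evalWord-++ (τWord a d) (c ∷ []) x) ⟩
  σ c (evalWord (τWord a d) (σ c x))       ≡⟨ cong (σ c) (τWord-eval a d (σ c x)) ⟩
  σ c (τ a c (σ c x))                      ≡⟨ σ-conj-τ (m<m+n a (s≤s z≤n)) x ⟩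
  τ a (suc c) x                            ≡⟨ cong (λ b → τ a b x) (+-suc a (suc d)) ⟨
  τ a (a + suc (suc d)) x                  ∎
  where
  open ≡-Reasoning
  c : ℕ
  c = a + suc d

τWord-letters : ∀ a d → All (λ c → a ≤ c × c ≤ a + d) (τWord a d)
τWord-letters a zero = (≤-refl , m≤m+n a 0) ∷ []
τWord-letters a (suc d) =
  (m≤m+n a (suc d) , ≤-refl) ∷
  ++⁺ᴬ (All-map (λ (a≤c , c≤a+d) → a≤c , ≤-trans c≤a+d (+-monoʳ-≤ a (n≤1+n d)))
               (τWord-letters a d))
       ((m≤m+n a (suc d) , ≤-refl) ∷ [])

τWord-letters-inRange : ∀ {n a b} → 1 ≤ a → a < b → b ≤ n →
  All (InRange (n ∸ 1)) (τWord a (b ∸ suc a))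
τWord-letters-inRange {n} {a} {b} 1≤a a<b b≤n =
  All-map (λ (a≤c , c≤a+d) → ≤-trans 1≤a a≤c , <⇒≤∸1 (<-≤-trans (<b c≤a+d) b≤n))
          (τWord-letters a (b ∸ suc a))
  where
  <b : ∀ {c} → c ≤ a + (b ∸ suc a) → c < b
  <b c≤a+d = <-≤-trans (s≤s c≤a+d) (≤-reflexive (trans (sym (+-suc a _)) (+suc[∸suc] a<b)))

τ-word : ∀ {n a b} → InRange n a → InRange n b →
  ∃[ ws ] (All (InRange (n ∸ 1)) ws × ∀ x → evalWord ws x ≡ τ a b x)
τ-word {n} {a} {b} (1≤a , a≤n) (1≤b , b≤n) with <-cmp a b
... | tri≈ _ refl _ = [] , [] , λ x → sym (τ-self a x)
... | tri< a<b _ _ = τWord a (b ∸ suc a) , τWord-letters-inRange 1≤a a<b b≤n ,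
  λ x → trans (τWord-eval a _ x) (cong (λ c → τ a c x) (+suc[∸suc] a<b))
... | tri> _ _ b<a = τWord b (a ∸ suc b) , τWord-letters-inRange 1≤b b<a a≤n ,
  λ x → trans (τWord-eval b _ x) (trans (cong (λ c → τ b c x) (+suc[∸suc] b<a)) (τ-sym b a x))

-- Ranks and the subword property

indicator : {P : Set} → Dec P → ℕ
indicator (yes _) = 1
indicator (no _) = 0

indicator-yes : ∀ {P : Set} (d : Dec P) → P → indicator d ≡ 1
indicator-yes (yes _) _ = refl
indicator-yes (no ¬p) p = ⊥-elim (¬p p)

indicator-no : ∀ {P : Set} (d : Dec P) → ¬ P → indicator d ≡ 0
indicator-no (yes p) ¬p = ⊥-elim (¬p p)
indicator-no (no _) _ = refl

-- Comparing ranks is the rank-matrix description of the Bruhat order.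
rank : (ℕ → ℕ) → ℕ → ℕ → ℕ
rank f zero q = 0
rank f (suc p) q = indicator (q ≤? f p) + rank f p q

occurrences : (ℕ → ℕ) → ℕ → ℕ → ℕ
occurrences f zero b = 0
occurrences f (suc p) b = indicator (f p ≟ b) + occurrences f p b

indicator-≤-split : ∀ q v → indicator (q ≤? v) ≡ indicator (suc q ≤? v) + indicator (v ≟ q)
indicator-≤-split q v with q ≤? v | suc q ≤? v | v ≟ q
... | yes _ | yes q<v | yes refl = ⊥-elim (<-irrefl refl q<v)
... | yes _ | yes _ | no _ = refl
... | yes _ | no _ | yes _ = refl
... | yes q≤v | no q≮v | no v≢q = ⊥-elim (q≮v (≤∧≢⇒< q≤v (≢-sym v≢q)))
... | no q≰v | yes q<v | _ = ⊥-elim (q≰v (<⇒≤ q<v))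
... | no q≰v | no _ | yes refl = ⊥-elim (q≰v ≤-refl)
... | no _ | no _ | no _ = refl

rank-split : ∀ f p q → rank f p q ≡ rank f p (suc q) + occurrences f p q
rank-split f zero q = refl
rank-split f (suc p) q
  rewrite rank-split f p q | indicator-≤-split q (f p) =
  interchange (indicator (suc q ≤? f p)) (indicator (f p ≟ q)) (rank f p (suc q)) (occurrences f p q)

indicator-≤-1+b : ∀ b q → q ≢ suc b → indicator (q ≤? suc b) ≡ indicator (q ≤? b)
indicator-≤-1+b b q q≢1+b with q ≤? suc b | q ≤? b
... | yes q≤1+b | no q≰b = ⊥-elim (q≢1+b (≤-antisym q≤1+b (≰⇒> q≰b)))
... | no q≰1+b | yes q≤b = ⊥-elim (q≰1+b (m≤n⇒m≤1+n q≤b))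
... | yes _ | yes _ = refl
... | no _ | no _ = refl

indicator-≤-σ-other : ∀ b q v → q ≢ suc b → indicator (q ≤? σ b v) ≡ indicator (q ≤? v)
indicator-≤-σ-other b q v q≢1+b with swapView b v
... | left refl rewrite σ-left b = indicator-≤-1+b b q q≢1+b
... | right refl rewrite σ-right b = sym (indicator-≤-1+b b q q≢1+b)
... | other v≢b v≢1+b rewrite σ-other b v≢b v≢1+b = refl

rank-σ-other : ∀ b f p q → q ≢ suc b → rank (σ b ∘ f) p q ≡ rank f p q
rank-σ-other b f zero q q≢1+b = refl
rank-σ-other b f (suc p) q q≢1+b
  rewrite indicator-≤-σ-other b q (f p) q≢1+b | rank-σ-other b f p q q≢1+b = refl

indicator-≤-σ-at : ∀ b v →
  indicator (suc b ≤? σ b v) ≡ indicator (suc (suc b) ≤? v) + indicator (v ≟ b)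
indicator-≤-σ-at b v with swapView b v
... | left refl
  rewrite σ-left b | indicator-yes (suc b ≤? suc b) ≤-refl
        | indicator-no (suc (suc b) ≤? b) (<⇒≱ (m<n⇒m<1+n (n<1+n b))) | indicator-yes (b ≟ b) refl = refl
... | right refl
  rewrite σ-right b | indicator-no (suc b ≤? b) (<-irrefl refl)
        | indicator-no (suc (suc b) ≤? suc b) (<-irrefl refl)
        | indicator-no (suc b ≟ b) (>⇒≢ (n<1+n b)) = refl
... | other v≢b v≢1+b
  rewrite σ-other b v≢b v≢1+b | indicator-≤-split (suc b) v
        | indicator-no (v ≟ suc b) v≢1+b | indicator-no (v ≟ b) v≢b = refl

rank-σ-at : ∀ b f p → rank (σ b ∘ f) p (suc b) ≡ rank f p (suc (suc b)) + occurrences f p b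
rank-σ-at b f zero = refl
rank-σ-at b f (suc p) rewrite indicator-≤-σ-at b (f p) | rank-σ-at b f p =
  interchange (indicator (suc (suc b) ≤? f p)) (indicator (f p ≟ b)) (rank f p (suc (suc b))) (occurrences f p b)

occurrences-pos⇒∃ : ∀ f p b → 1 ≤ occurrences f p b → ∃[ a ] (a < p × f a ≡ b)
occurrences-pos⇒∃ f (suc p) b pos with f p ≟ b
... | yes fp≡b = p , ≤-refl , fp≡b
... | no _ with occurrences-pos⇒∃ f p b pos
...   | a , a<p , fa≡b = a , m≤n⇒m≤1+n a<p , fa≡b

∃⇒occurrences-pos : ∀ f {p a b} → a < p → f a ≡ b → 1 ≤ occurrences f p b
∃⇒occurrences-pos f {suc p} {a} {b} a<1+p fa≡b with f p ≟ b | a ≟ p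
... | yes _ | _ = s≤s z≤n
... | no fp≢b | yes refl = ⊥-elim (fp≢b fa≡b)
... | no _ | no a≢p = ∃⇒occurrences-pos f (≤∧≢⇒< (≤-pred a<1+p) a≢p) fa≡b

occurrences≤1 : ∀ {f} → Injective _≡_ _≡_ f → ∀ p b → occurrences f p b ≤ 1
occurrences≤1 inj zero b = z≤n
occurrences≤1 {f} inj (suc p) b with f p ≟ b
... | no _ = occurrences≤1 inj p b
... | yes fp≡b with 1 ≤? occurrences f p b
...   | no ¬pos = s≤s (≤-pred (≰⇒> ¬pos))
...   | yes pos with occurrences-pos⇒∃ f p b pos
...     | a , a<p , fa≡b = ⊥-elim (<⇒≢ a<p (inj (trans fa≡b (sym fp≡b))))

-- σ b ∘ f is longer than f.
LeftAscent : ℕ → (ℕ → ℕ) → Set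
LeftAscent b f = ∀ {x y} → y < x → f x ≡ b → f y ≢ suc b

ascent⇒occurrences-≤ : ∀ {f b} → Injective _≡_ _≡_ f → LeftAscent b f → ∃[ x ] (f x ≡ b) →
  ∀ p → occurrences f p (suc b) ≤ occurrences f p b
ascent⇒occurrences-≤ {f} {b} inj asc (x , fx≡b) p with 1 ≤? occurrences f p (suc b)
... | no ¬pos = ≤-trans (≤-pred (≰⇒> ¬pos)) z≤n
... | yes pos with occurrences-pos⇒∃ f p (suc b) pos
...   | y , y<p , fy≡1+b with x <? p
...     | yes x<p = ≤-trans (occurrences≤1 inj p (suc b)) (∃⇒occurrences-pos f x<p fx≡b)
...     | no x≮p = ⊥-elim (asc (<-≤-trans y<p (≮⇒≥ x≮p)) fx≡b fy≡1+b)

RankBelow : (ℕ → ℕ) → (ℕ → ℕ) → Set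
RankBelow u f = ∀ p q → rank u p q ≤ rank f p q

rankBelow-σ-right : ∀ {u f b} → RankBelow u f → Injective _≡_ _≡_ f →
  LeftAscent b f → ∃[ x ] (f x ≡ b) → RankBelow u (σ b ∘ f)
rankBelow-σ-right {u} {f} {b} below inj asc hit p q with q ≟ suc b
... | no q≢1+b rewrite rank-σ-other b f p q q≢1+b = below p q
... | yes refl rewrite rank-σ-at b f p = begin
  rank u p (suc b)                                    ≤⟨ below p (suc b) ⟩
  rank f p (suc b)                                    ≡⟨ rank-split f p (suc b) ⟩
  rank f p (suc (suc b)) + occurrences f p (suc b)
    ≤⟨ +-monoʳ-≤ _ (ascent⇒occurrences-≤ inj asc hit p) ⟩
  rank f p (suc (suc b)) + occurrences f p b          ∎
  where open ≤-Reasoning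

rankBelow-σ-both : ∀ {u f b} → RankBelow u f → Injective _≡_ _≡_ u → Injective _≡_ _≡_ f →
  LeftAscent b f → ∃[ x ] (f x ≡ b) → RankBelow (σ b ∘ u) (σ b ∘ f)
rankBelow-σ-both {u} {f} {b} below injᵤ inj asc hit p q with q ≟ suc b
... | no q≢1+b rewrite rank-σ-other b u p q q≢1+b | rank-σ-other b f p q q≢1+b = below p q
... | yes refl rewrite rank-σ-at b u p | rank-σ-at b f p with 1 ≤? occurrences f p b
...   | yes pos = +-mono-≤ (below p (suc (suc b))) (≤-trans (occurrences≤1 injᵤ p b) pos)
...   | no ¬pos = begin
  rank u p (suc (suc b)) + occurrences u p b
    ≤⟨ +-monoˡ-≤ (occurrences u p b) (m≤m+n (rank u p (suc (suc b))) (occurrences u p (suc b))) ⟩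
  rank u p (suc (suc b)) + occurrences u p (suc b) + occurrences u p b
    ≡⟨ cong (_+ occurrences u p b) (rank-split u p (suc b)) ⟨
  rank u p (suc b) + occurrences u p b
    ≡⟨ rank-split u p b ⟨
  rank u p b
    ≤⟨ below p b ⟩
  rank f p b
    ≡⟨ rank-split f p b ⟩
  rank f p (suc b) + occurrences f p b
    ≡⟨ cong (_+ occurrences f p b) (trans (rank-split f p (suc b)) (cong (rank f p (suc (suc b)) +_) no-b+1)) ⟩
  rank f p (suc (suc b)) + 0 + occurrences f p b
    ≡⟨ cong (_+ occurrences f p b) (+-identityʳ _) ⟩
  rank f p (suc (suc b)) + occurrences f p b
    ∎
  where
  open ≤-Reasoning
  -- b does not occur before p, so neither does b + 1
  no-b+1 : occurrences f p (suc b) ≡ 0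
  no-b+1 = n≤0⇒n≡0 (≤-trans (ascent⇒occurrences-≤ inj asc hit p) (≤-pred (≰⇒> ¬pos)))

AllLeftAscents : List ℕ → Set
AllLeftAscents [] = ⊤
AllLeftAscents (b ∷ ws) = LeftAscent b (evalWord ws) × AllLeftAscents ws

subword⇒rankBelow : ∀ {vs ws} → vs ⊆ ws → AllLeftAscents ws → RankBelow (evalWord vs) (evalWord ws)
subword⇒rankBelow [] _ p q = ≤-refl
subword⇒rankBelow {vs} {b ∷ ws} (.b ∷ʳ vs⊆ws) (asc , ascs) =
  rankBelow-σ-right (subword⇒rankBelow vs⊆ws ascs) (evalWord-injective ws) asc (evalWord-surjective ws b)
subword⇒rankBelow {b ∷ vs} {.b ∷ ws} (refl ∷ vs⊆ws) (asc , ascs) =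
  rankBelow-σ-both (subword⇒rankBelow vs⊆ws ascs) (evalWord-injective vs) (evalWord-injective ws)
    asc (evalWord-surjective ws b)

-- Reduced words

record Deletion (b : ℕ) (ws : List ℕ) : Set where
  field
    word : List ℕ
    sublist : word ⊆ ws
    shorter : length word < length ws
    σ-evalWord : ∀ z → σ b (evalWord ws z) ≡ evalWord word z

-- The deletion property.  Peeling letters off the right end moves the inverted
-- pair of positions (y, x) along, until the peeled letter is the one creating it.
deletion : ∀ {ws} → Reverse ws → ∀ {b x y} → y < x →
  evalWord ws x ≡ b → evalWord ws y ≡ suc b → Deletion b ws
deletion [] y<x refl refl = ⊥-elim (<-asym y<x (n<1+n _))
deletion (ws ∶ rws ∶ʳ c) {b} {x} {y} y<x wsc-x wsc-y with (y ≟ c) ×-dec (x ≟ suc c)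
... | yes (refl , refl) = record
  { word = ws
  ; sublist = ++⁺ʳ (c ∷ []) ⊆-refl
  ; shorter = ≤-reflexive (sym (length-∷ʳ ws c))
  ; σ-evalWord = λ z → begin
      σ b (evalWord (ws ++ c ∷ []) z)   ≡⟨ cong (σ b) (evalWord-++ ws (c ∷ []) z) ⟩
      σ b (evalWord ws (σ c z))         ≡⟨ σ-intertwine (evalWord-injective ws) ws-c ws-c+1 (σ c z) ⟩
      evalWord ws (σ c (σ c z))         ≡⟨ cong (evalWord ws) (σ-involutive c z) ⟩
      evalWord ws z                     ∎
  }
  where
  open ≡-Reasoning
  ws-c : evalWord ws c ≡ b
  ws-c = trans (cong (evalWord ws) (sym (σ-right c))) (trans (sym (evalWord-++ ws (c ∷ []) x)) wsc-x)
  ws-c+1 : evalWord ws (suc c) ≡ suc b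
  ws-c+1 = trans (cong (evalWord ws) (sym (σ-left c))) (trans (sym (evalWord-++ ws (c ∷ []) y)) wsc-y)
... | no ¬swapped = record
  { word = word ++ c ∷ []
  ; sublist = ++⁺ sublist ⊆-refl
  ; shorter = subst₂ _<_ (sym (length-∷ʳ word c)) (sym (length-∷ʳ ws c)) (s≤s shorter)
  ; σ-evalWord = λ z → begin
      σ b (evalWord (ws ++ c ∷ []) z)   ≡⟨ cong (σ b) (evalWord-++ ws (c ∷ []) z) ⟩
      σ b (evalWord ws (σ c z))         ≡⟨ σ-evalWord (σ c z) ⟩
      evalWord word (σ c z)             ≡⟨ evalWord-++ word (c ∷ []) z ⟨
      evalWord (word ++ c ∷ []) z       ∎
  }
  where
  open ≡-Reasoning
  open Deletion (deletion rws (σ-mono-< c y<x ¬swapped)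
    (trans (sym (evalWord-++ ws (c ∷ []) x)) wsc-x) (trans (sym (evalWord-++ ws (c ∷ []) y)) wsc-y))

reduced⇒allLeftAscents : ∀ {n} (w : Permutation′ n) P ws → IsReduced w (P ++ ws) → AllLeftAscents ws
reduced⇒allLeftAscents w P [] _ = tt
reduced⇒allLeftAscents w P (b ∷ ws) ((letters , evaluates) , minimal) =
  ascent , reduced⇒allLeftAscents w (P ++ b ∷ []) ws
             (subst (IsReduced w) (sym (++-assoc P (b ∷ []) ws)) ((letters , evaluates) , minimal))
  where
  ascent : LeftAscent b (evalWord ws)
  ascent y<x ws-x ws-y = <⇒≱ shorter′ (minimal (P ++ word) isWord′)
    where
    open Deletion (deletion (reverseView ws) y<x ws-x ws-y)
    isWord′ : IsWord w (P ++ word)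
    isWord′ = All-resp-⊆ (++⁺ ⊆-refl (b ∷ʳ sublist)) letters , λ i → begin
      evalWord (P ++ word) _            ≡⟨ evalWord-++ P word _ ⟩
      evalWord P (evalWord word _)      ≡⟨ cong (evalWord P) (σ-evalWord _) ⟨
      evalWord P (σ b (evalWord ws _))  ≡⟨ evalWord-++ P (b ∷ ws) _ ⟨
      evalWord (P ++ b ∷ ws) _          ≡⟨ evaluates i ⟩
      _                                 ∎
      where open ≡-Reasoning
    shorter′ : length (P ++ word) < length (P ++ b ∷ ws)
    shorter′ rewrite length-++ P {word} | length-++ P {b ∷ ws} = +-monoʳ-< (length P) (m<n⇒m<1+n shorter)

PC-transpose-τ : ∀ {n} (i j z : Fin n) →
  suc (toℕ (PC.transpose i j z)) ≡ τ (suc (toℕ i)) (suc (toℕ j)) (suc (toℕ z))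
PC-transpose-τ i j z with z ≟ᶠ i
... | yes refl = sym (τ-left (suc (toℕ z)) (suc (toℕ j)))
... | no z≢i with z ≟ᶠ j
...   | yes refl = sym (τ-right (suc (toℕ i)) (suc (toℕ z)))
...   | no z≢j =
  sym (τ-other _ _ (z≢i ∘ toℕ-injective ∘ suc-injective) (z≢j ∘ toℕ-injective ∘ suc-injective))

transpositions-word : ∀ {n} (ts : TranspositionList n) →
  ∃[ ws ] (All (InRange (n ∸ 1)) ws ×
           ∀ z → evalWord ws (suc (toℕ z)) ≡ suc (toℕ (eval ts ⟨$⟩ʳ z)))
transpositions-word [] = [] , [] , λ z → refl
transpositions-word ((i , j) ∷ ts) with transpositions-word ts
                                      | τ-word (s≤s z≤n , toℕ<n i) (s≤s z≤n , toℕ<n j)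
... | ws , letters , evaluates | vs , letters′ , evaluates′ =
  ws ++ vs , ++⁺ᴬ letters letters′ , λ z → begin
    evalWord (ws ++ vs) (suc (toℕ z))                                 ≡⟨ evalWord-++ ws vs _ ⟩
    evalWord ws (evalWord vs (suc (toℕ z)))                           ≡⟨ cong (evalWord ws) (evaluates′ _) ⟩
    evalWord ws (τ (suc (toℕ i)) (suc (toℕ j)) (suc (toℕ z)))
      ≡⟨ cong (evalWord ws) (PC-transpose-τ i j z) ⟨
    evalWord ws (suc (toℕ (PC.transpose i j z)))                      ≡⟨ evaluates _ ⟩
    suc (toℕ (eval ts ⟨$⟩ʳ PC.transpose i j z))                       ∎
  where open ≡-Reasoning

word-exists : ∀ {n} (w : Permutation′ n) → ∃[ ws ] IsWord w ws
word-exists w with transpositions-word (decompose w)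
... | ws , letters , evaluates =
  ws , letters , λ z → trans (evaluates z) (cong (suc ∘ toℕ) (eval-decompose w z))

shortWord? : ∀ N (Q : List ℕ → Set) → (∀ ws → Dec (Q ws)) → ∀ ℓ →
  Dec (∃[ ws ] (All (InRange N) ws × length ws ≤ ℓ × Q ws))
shortWord? N Q Q? ℓ with Q? []
... | yes q = yes ([] , [] , z≤n , q)
shortWord? N Q Q? zero | no ¬q = no λ { ([] , _ , _ , q) → ¬q q }
shortWord? N Q Q? (suc ℓ) | no ¬q
  with ∃-inRange? (λ a → shortWord? N (Q ∘ (a ∷_)) (Q? ∘ (a ∷_)) ℓ) N
... | yes (a , inRange , ws , letters , len , q) = yes (a ∷ ws , inRange ∷ letters , s≤s len , q)
... | no none = no λ
  { ([] , _ , _ , q) → ¬q q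
  ; (a ∷ ws , inRange ∷ letters , s≤s len , q) → none (a , inRange , ws , letters , len , q) }

reduced-exists : ∀ {n} (w : Permutation′ n) → ∃[ ws ] IsReduced w ws
reduced-exists {n} w = shortest _ (proj₂ (word-exists w)) ≤-refl
  where
  evaluates? : ∀ ws → Dec (∀ i → evalWord ws (suc (toℕ i)) ≡ suc (toℕ (w ⟨$⟩ʳ i)))
  evaluates? ws = all? (λ i → evalWord ws (suc (toℕ i)) ≟ suc (toℕ (w ⟨$⟩ʳ i)))
  shortest : ∀ ℓ {ws} → IsWord w ws → length ws ≤ ℓ → ∃[ vs ] IsReduced w vs
  shortest zero {ws} isWord len = ws , isWord , λ _ _ → ≤-trans len z≤n
  shortest (suc ℓ) {ws} isWord len with shortWord? (n ∸ 1) _ evaluates? ℓ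
  ... | yes (vs , letters , len′ , evaluates) = shortest ℓ (letters , evaluates) len′
  ... | no none = ws , isWord , λ vs (letters , evaluates) →
    ≤-trans len (≰⇒> (λ len′ → none (vs , letters , len′ , evaluates)))

-- Interlacing as a Bruhat condition

fun-suc : ∀ {n} (w : Permutation′ n) {j} (j<n : j < n) →
  fun w (suc j) ≡ suc (toℕ (w ⟨$⟩ʳ fromℕ< j<n))
fun-suc {n} w {j} j<n with j <? n
... | yes _ = refl
... | no j≮n = ⊥-elim (j≮n j<n)

evalWord-fun : ∀ {n} {w : Permutation′ n} {ws} → IsWord w ws →
  ∀ {a} → InRange n a → evalWord ws a ≡ fun w a
evalWord-fun {w = w} {ws} (_ , evaluates) {suc j} (_ , j<n) = begin
  evalWord ws (suc j)                         ≡⟨ cong (evalWord ws ∘ suc) (toℕ-fromℕ< j<n) ⟨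
  evalWord ws (suc (toℕ (fromℕ< j<n)))        ≡⟨ evaluates (fromℕ< j<n) ⟩
  suc (toℕ (w ⟨$⟩ʳ fromℕ< j<n))               ≡⟨ fun-suc w j<n ⟨
  fun w (suc j)                               ∎
  where open ≡-Reasoning

rank-pos⇒∃ : ∀ f p q → 1 ≤ rank f p q → ∃[ a ] (a < p × q ≤ f a)
rank-pos⇒∃ f (suc p) q pos with q ≤? f p
... | yes q≤fp = p , ≤-refl , q≤fp
... | no _ with rank-pos⇒∃ f p q pos
...   | a , a<p , q≤fa = a , m≤n⇒m≤1+n a<p , q≤fa

rank≥2⇒∃₂ : ∀ f p q → 2 ≤ rank f p q →
  ∃[ a ] ∃[ a′ ] (a < a′ × a′ < p × q ≤ f a × q ≤ f a′)
rank≥2⇒∃₂ f (suc p) q two with q ≤? f p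
... | yes q≤fp with rank-pos⇒∃ f p q (≤-pred two)
...   | a , a<p , q≤fa = a , p , a<p , ≤-refl , q≤fa , q≤fp
rank≥2⇒∃₂ f (suc p) q two | no _ with rank≥2⇒∃₂ f p q two
...   | a , a′ , a<a′ , a′<p , q≤fa , q≤fa′ =
  a , a′ , a<a′ , m≤n⇒m≤1+n a′<p , q≤fa , q≤fa′

≤-value⇒rank-pos : ∀ f {p q} → q ≤ f p → 1 ≤ rank f (suc p) q
≤-value⇒rank-pos f {p} {q} q≤fp rewrite indicator-yes (q ≤? f p) q≤fp = s≤s z≤n

≤-values⇒rank≥2 : ∀ f {p q} → q ≤ f p → q ≤ f (suc p) → 2 ≤ rank f (suc (suc p)) q
≤-values⇒rank≥2 f {p} {q} q≤fp q≤fp+1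
  rewrite indicator-yes (q ≤? f (suc p)) q≤fp+1 = s≤s (≤-value⇒rank-pos f q≤fp)

RisesOver : (ℕ → ℕ) → ℕ → Set
RisesOver f K = ∃[ a ] (1 ≤ a × a < K × K < f a)

TwoAtLeast : (ℕ → ℕ) → ℕ → Set
TwoAtLeast f K = ∃[ a ] ∃[ a′ ] (1 ≤ a × a < a′ × a′ ≤ K × K ≤ f a × K ≤ f a′)

-- The rank conditions for  s_k s_{k+1} s_k ≤ f  in the Bruhat order, where K = k + 1.
Above321At : (ℕ → ℕ) → ℕ → Set
Above321At f K = RisesOver f K × TwoAtLeast f K

rankBelow⇒above321 : ∀ {n} {w : Permutation′ n} {ws k} → IsWord w ws → suc (suc k) ≤ n →
  ∀ {u} → u k ≡ suc (suc k) → u (suc k) ≡ suc k → RankBelow u (evalWord ws) →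
  Above321At (fun w) (suc k)
rankBelow⇒above321 {n} {w} {ws} {k} isWord k+2≤n {u} uk uk+1 below = risesOver , twoAtLeast
  where
  E : ℕ → ℕ
  E = evalWord ws
  positive : ∀ {a q} → 1 ≤ q → q ≤ E a → 1 ≤ a
  positive {zero} 1≤q q≤E0 rewrite evalWord-zero (All-map proj₁ (proj₁ isWord)) = ≤-trans 1≤q q≤E0
  positive {suc a} _ _ = s≤s z≤n
  toFun : ∀ {a q} → 1 ≤ q → a ≤ suc k → q ≤ E a → q ≤ fun w a
  toFun 1≤q a≤k+1 q≤Ea =
    subst (_ ≤_) (evalWord-fun isWord (positive 1≤q q≤Ea , ≤-trans a≤k+1 (≤-trans (n≤1+n _) k+2≤n)))
          q≤Ea
  risesOver : RisesOver (fun w) (suc k)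
  risesOver with rank-pos⇒∃ E (suc k) (suc (suc k))
                  (≤-trans (≤-value⇒rank-pos u (≤-reflexive (sym uk))) (below (suc k) (suc (suc k))))
  ... | a , a<k+1 , k+2≤Ea =
    a , positive (s≤s z≤n) k+2≤Ea , a<k+1 , toFun (s≤s z≤n) (<⇒≤ a<k+1) k+2≤Ea
  twoAtLeast : TwoAtLeast (fun w) (suc k)
  twoAtLeast with rank≥2⇒∃₂ E (suc (suc k)) (suc k)
                   (≤-trans (≤-values⇒rank≥2 u (≤-trans (n≤1+n _) (≤-reflexive (sym uk)))
                                                (≤-reflexive (sym uk+1)))
                            (below (suc (suc k)) (suc k)))
  ... | a , a′ , a<a′ , a′<k+2 , k+1≤Ea , k+1≤Ea′ =
    a , a′ , positive (s≤s z≤n) k+1≤Ea , a<a′ , ≤-pred a′<k+2 ,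
    toFun (s≤s z≤n) (≤-trans (<⇒≤ a<a′) (≤-pred a′<k+2)) k+1≤Ea ,
    toFun (s≤s z≤n) (≤-pred a′<k+2) k+1≤Ea′

module _ (k : ℕ) where
  private
    k≢k+1 : k ≢ suc k
    k≢k+1 = <⇒≢ (n<1+n k)
    k≢k+2 : k ≢ suc (suc k)
    k≢k+2 = <⇒≢ (m<n⇒m<1+n (n<1+n k))
    k+2≢k : suc (suc k) ≢ k
    k+2≢k = ≢-sym k≢k+2
    k+2≢k+1 : suc (suc k) ≢ suc k
    k+2≢k+1 = >⇒≢ (n<1+n (suc k))

  σσσ-at-k : evalWord (k ∷ suc k ∷ k ∷ []) k ≡ suc (suc k)
  σσσ-at-k rewrite σ-left k | σ-left (suc k) = σ-other k k+2≢k k+2≢k+1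

  σσσ-at-k+1 : evalWord (k ∷ suc k ∷ k ∷ []) (suc k) ≡ suc k
  σσσ-at-k+1 rewrite σ-right k | σ-other (suc k) k≢k+1 k≢k+2 = σ-left k

  σσσ′-at-k : evalWord (suc k ∷ k ∷ suc k ∷ []) k ≡ suc (suc k)
  σσσ′-at-k rewrite σ-other (suc k) k≢k+1 k≢k+2 | σ-left k = σ-left (suc k)

  σσσ′-at-k+1 : evalWord (suc k ∷ k ∷ suc k ∷ []) (suc k) ≡ suc k
  σσσ′-at-k+1 rewrite σ-left (suc k) | σ-other k k+2≢k k+2≢k+1 = σ-right (suc k)

interlaced⇒above321 : ∀ {n} (w : Permutation′ n) k → suc (suc k) ≤ n → Interlaced w k →
  Above321At (fun w) (suc k)
interlaced⇒above321 w k k+2≤n (_ , ws , reduced , inj₁ braid) =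
  rankBelow⇒above321 (proj₁ reduced) k+2≤n (σσσ-at-k k) (σσσ-at-k+1 k)
    (subword⇒rankBelow braid (reduced⇒allLeftAscents w [] ws reduced))
interlaced⇒above321 w k k+2≤n (_ , ws , reduced , inj₂ braid) =
  rankBelow⇒above321 (proj₁ reduced) k+2≤n (σσσ′-at-k k) (σσσ′-at-k+1 k)
    (subword⇒rankBelow braid (reduced⇒allLeftAscents w [] ws reduced))

∉⇒evalWord-≤ : ∀ ws {c} → c ∉ ws → ∀ {x} → x ≤ c → evalWord ws x ≤ c
∉⇒evalWord-≤ [] c∉ws x≤c = x≤c
∉⇒evalWord-≤ (a ∷ ws) {c} c∉ws {x} x≤c with swapView a (evalWord ws x)
... | left eq rewrite eq | σ-left a =
  ≤∧≢⇒< (subst (_≤ c) eq (∉⇒evalWord-≤ ws (c∉ws ∘ there) x≤c)) (c∉ws ∘ here ∘ sym)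
... | right eq rewrite eq | σ-right a =
  ≤-trans (n≤1+n a) (subst (_≤ c) eq (∉⇒evalWord-≤ ws (c∉ws ∘ there) x≤c))
... | other ≢a ≢1+a rewrite σ-other a ≢a ≢1+a = ∉⇒evalWord-≤ ws (c∉ws ∘ there) x≤c

AllBefore : ℕ → ℕ → List ℕ → Set
AllBefore x y L = ∃[ P ] ∃[ S ] (L ≡ P ++ S × y ∉ P × x ∉ S)

data Arrangement (x y : ℕ) (L : List ℕ) : Set where
  xyx : (x ∷ y ∷ x ∷ []) ⊆ L → Arrangement x y L
  yxy : (y ∷ x ∷ y ∷ []) ⊆ L → Arrangement x y L
  x-before-y : AllBefore x y L → Arrangement x y L
  y-before-x : AllBefore y x L → Arrangement x y L

allBefore-∷ : ∀ {x y} → x ≢ y → ∀ c {L} → AllBefore x y L →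
  (y ∷ x ∷ y ∷ []) ⊆ c ∷ L ⊎ AllBefore x y (c ∷ L) ⊎ AllBefore y x (c ∷ L)
allBefore-∷ {x} {y} x≢y c (P , S , refl , y∉P , x∉S) with c ≟ y
... | no c≢y = inj₂ (inj₁ (c ∷ P , S , refl , ∉-∷ (c≢y ∘ sym) y∉P , x∉S))
... | yes refl with x ∈? P | c ∈? S
...   | yes x∈P | yes y∈S = inj₁ (refl ∷ ++⁺ (from∈ x∈P) (from∈ y∈S))
...   | no x∉P | _ =
  inj₂ (inj₂ (c ∷ P ++ S , [] , sym (++-identityʳ _) , ∉-∷ x≢y (∉-++ x∉P x∉S) , λ ()))
...   | yes _ | no y∉S = inj₂ (inj₂ (c ∷ [] , P ++ S , refl , ∉-∷ x≢y (λ ()) , ∉-++ y∉P y∉S))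

arrangement : ∀ {x y} → x ≢ y → ∀ L → Arrangement x y L
arrangement x≢y [] = x-before-y ([] , [] , refl , (λ ()) , (λ ()))
arrangement x≢y (c ∷ L) with arrangement x≢y L
... | xyx sub = xyx (c ∷ʳ sub)
... | yxy sub = yxy (c ∷ʳ sub)
... | x-before-y before with allBefore-∷ x≢y c before
...   | inj₁ sub = yxy sub
...   | inj₂ (inj₁ before′) = x-before-y before′
...   | inj₂ (inj₂ before′) = y-before-x before′
arrangement x≢y (c ∷ L) | y-before-x before with allBefore-∷ (≢-sym x≢y) c before
...   | inj₁ sub = xyx sub
...   | inj₂ (inj₁ before′) = y-before-x before′
...   | inj₂ (inj₂ before′) = x-before-y before′

module _ {n} {w : Permutation′ n} {k} (k+2≤n : suc (suc k) ≤ n) where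
  private
    inRange : ∀ {a} → 1 ≤ a → a ≤ suc k → InRange n a
    inRange 1≤a a≤k+1 = 1≤a , ≤-trans a≤k+1 (≤-trans (n≤1+n _) k+2≤n)

  allBefore⇒¬risesOver : ∀ {ws} → IsWord w ws → AllBefore k (suc k) ws → ¬ RisesOver (fun w) (suc k)
  allBefore⇒¬risesOver isWord (P , S , refl , k+1∉P , k∉S) (a , 1≤a , a<k+1 , k+1<wa) =
    <⇒≱ k+1<wa (begin
      fun w a                     ≡⟨ evalWord-fun isWord (inRange 1≤a (<⇒≤ a<k+1)) ⟨
      evalWord (P ++ S) a         ≡⟨ evalWord-++ P S a ⟩
      evalWord P (evalWord S a)
        ≤⟨ ∉⇒evalWord-≤ P k+1∉P (m≤n⇒m≤1+n (∉⇒evalWord-≤ S k∉S (≤-pred a<k+1))) ⟩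
      suc k                       ∎)
    where open ≤-Reasoning

  -- A position a ≤ k + 1 with value ≥ k + 1 must be sent to exactly k + 1 by S,
  -- and S is injective.
  allBefore⇒¬twoAtLeast : ∀ {ws} → IsWord w ws → AllBefore (suc k) k ws → ¬ TwoAtLeast (fun w) (suc k)
  allBefore⇒¬twoAtLeast isWord (P , S , refl , k∉P , k+1∉S)
                        (a , a′ , 1≤a , a<a′ , a′≤k+1 , k+1≤wa , k+1≤wa′) =
    <⇒≢ a<a′ (evalWord-injective S (trans (S-at-k+1 1≤a (≤-trans (<⇒≤ a<a′) a′≤k+1) k+1≤wa)
                                          (sym (S-at-k+1 (≤-trans 1≤a (<⇒≤ a<a′)) a′≤k+1 k+1≤wa′))))
    where
    S-at-k+1 : ∀ {b} → 1 ≤ b → b ≤ suc k → suc k ≤ fun w b → evalWord S b ≡ suc k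
    S-at-k+1 {b} 1≤b b≤k+1 k+1≤wb with evalWord S b ≟ suc k
    ... | yes eq = eq
    ... | no ≢k+1 = ⊥-elim (<⇒≱ (s≤s (begin
      fun w b                     ≡⟨ evalWord-fun isWord (inRange 1≤b b≤k+1) ⟨
      evalWord (P ++ S) b         ≡⟨ evalWord-++ P S b ⟩
      evalWord P (evalWord S b)
        ≤⟨ ∉⇒evalWord-≤ P k∉P (≤-pred (≤∧≢⇒< (∉⇒evalWord-≤ S k+1∉S b≤k+1) ≢k+1)) ⟩
      k                           ∎)) k+1≤wb)
      where open ≤-Reasoning

  above321⇒interlaced : Above321At (fun w) (suc k) → Interlaced w k
  above321⇒interlaced (rises@(a , 1≤a , a<k+1 , k+1<wa) , twoAtLeast) = contains , braid
    where
    -- a letter c with a ≤ c ≤ k + 1 is needed to move a past k + 1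
    occurs : ∀ {ws} → IsWord w ws → ∀ c → a ≤ c → c ≤ suc k → c ∈ ws
    occurs {ws} isWord c a≤c c≤k+1 with c ∈? ws
    ... | yes c∈ws = c∈ws
    ... | no c∉ws = ⊥-elim (<⇒≱ k+1<wa (begin
      fun w a          ≡⟨ evalWord-fun isWord (inRange 1≤a (<⇒≤ a<k+1)) ⟨
      evalWord ws a    ≤⟨ ∉⇒evalWord-≤ ws c∉ws a≤c ⟩
      c                ≤⟨ c≤k+1 ⟩
      suc k            ∎))
      where open ≤-Reasoning
    contains : ∀ ws → IsReduced w ws → k ∈ ws × suc k ∈ ws
    contains ws (isWord , _) =
      occurs isWord k (≤-pred a<k+1) (n≤1+n k) , occurs isWord (suc k) (<⇒≤ a<k+1) ≤-refl
    braid : ∃[ ws ] (IsReduced w ws ×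
                     ((k ∷ suc k ∷ k ∷ []) ⊆ ws ⊎ (suc k ∷ k ∷ suc k ∷ []) ⊆ ws))
    braid with reduced-exists w
    ... | ws , reduced with arrangement (<⇒≢ (n<1+n k)) ws
    ...   | xyx sub = ws , reduced , inj₁ sub
    ...   | yxy sub = ws , reduced , inj₂ sub
    ...   | x-before-y before = ⊥-elim (allBefore⇒¬risesOver (proj₁ reduced) before rises)
    ...   | y-before-x before = ⊥-elim (allBefore⇒¬twoAtLeast (proj₁ reduced) before twoAtLeast)

interlaced⇔above321 : ∀ {n} (w : Permutation′ n) k → suc (suc k) ≤ n →
  Interlaced w k ⇔ Above321At (fun w) (suc k)
interlaced⇔above321 w k k+2≤n =
  mk⇔ (interlaced⇒above321 w k k+2≤n) (above321⇒interlaced k+2≤n)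

-- The permutation w⟨k⟩

module _ {n} (w : Permutation′ n) where

  fun-range : ∀ {x} → InRange n x → InRange n (fun w x)
  fun-range {suc j} (_ , j<n) rewrite fun-suc w j<n = s≤s z≤n , toℕ<n _

  fun-injective : ∀ {x y} → InRange n x → InRange n y → fun w x ≡ fun w y → x ≡ y
  fun-injective {suc i} {suc j} (_ , i<n) (_ , j<n) eq rewrite fun-suc w i<n | fun-suc w j<n = begin
    suc i                       ≡⟨ cong suc (toℕ-fromℕ< i<n) ⟨
    suc (toℕ (fromℕ< i<n))
      ≡⟨ cong (suc ∘ toℕ) (Fin-injective (toℕ-injective (suc-injective eq))) ⟩
    suc (toℕ (fromℕ< j<n))      ≡⟨ cong suc (toℕ-fromℕ< j<n) ⟩
    suc j                       ∎
    where
    open ≡-Reasoning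
    Fin-injective : ∀ {x y} → w ⟨$⟩ʳ x ≡ w ⟨$⟩ʳ y → x ≡ y
    Fin-injective {x} {y} eq′ = trans (sym (inverseˡ w)) (trans (cong (w ⟨$⟩ˡ_) eq′) (inverseˡ w))

  fun-funInv : ∀ {y} → InRange n y → fun w (funInv w y) ≡ y
  fun-funInv {suc j} (_ , j<n) rewrite fun-suc (flip w) j<n = begin
    fun w (suc (toℕ (w ⟨$⟩ˡ fromℕ< j<n)))    ≡⟨ fun-suc w (toℕ<n _) ⟩
    suc (toℕ (w ⟨$⟩ʳ fromℕ< (toℕ<n _)))
      ≡⟨ cong (λ x → suc (toℕ (w ⟨$⟩ʳ x))) (fromℕ<-toℕ _ (toℕ<n _)) ⟩
    suc (toℕ (w ⟨$⟩ʳ (w ⟨$⟩ˡ fromℕ< j<n)))    ≡⟨ cong (suc ∘ toℕ) (inverseʳ w) ⟩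
    suc (toℕ (fromℕ< j<n))                    ≡⟨ cong suc (toℕ-fromℕ< j<n) ⟩
    suc j                                     ∎
    where open ≡-Reasoning

InjectiveOn : ℕ → (ℕ → ℕ) → Set
InjectiveOn n f = ∀ {x y} → InRange n x → InRange n y → f x ≡ f y → x ≡ y

high-values-bound : ∀ {n K f} → (∀ {x} → InRange n x → f x ≤ n) → InjectiveOn n f →
  (position : Fin (suc (suc (n ∸ K))) → ℕ) → (∀ {i i′} → toℕ i < toℕ i′ → position i < position i′) →
  (∀ i → InRange n (position i)) → ¬ (∀ i → K ≤ f (position i))
high-values-bound {n} {K} {f} f≤n injective position increasing inRange high
  with pigeonhole (n<1+n (suc (n ∸ K))) (λ i → fromℕ< (s≤s (∸-monoˡ-≤ K (f≤n (inRange i)))))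
... | i , i′ , i<i′ , same = <⇒≢ (increasing i<i′) (injective (inRange i) (inRange i′) (begin
  f (position i)                  ≡⟨ m∸n+n≡m (high i) ⟨
  f (position i) ∸ K + K
    ≡⟨ cong (_+ K) (trans (sym (toℕ-fromℕ< _)) (trans (cong toℕ same) (toℕ-fromℕ< _))) ⟩
  f (position i′) ∸ K + K         ≡⟨ m∸n+n≡m (high i′) ⟩
  f (position i′)                 ∎))
  where open ≡-Reasoning

-- The positions of TwoAtLeast together with the n ∸ K positions right of K
-- are too many to all carry one of the n ∸ K + 1 values ≥ K.
twoAtLeast⇒lowRight : ∀ {n K f} → (∀ {x} → InRange n x → f x ≤ n) → InjectiveOn n f → K ≤ n →
  TwoAtLeast f K → ∃[ j ] (K < j × j ≤ n × f j < K)
twoAtLeast⇒lowRight {n} {K} {f} f≤n injective K≤n (p , q , 1≤p , p<q , q≤K , K≤fp , K≤fq)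
  with ∃-inRange? (λ j → (K <? j) ×-dec (f j <? K)) n
... | yes (j , (_ , j≤n) , K<j , fj<K) = j , K<j , j≤n , fj<K
... | no none = ⊥-elim (high-values-bound f≤n injective position position-< position-inRange high)
  where
  position : Fin (suc (suc (n ∸ K))) → ℕ
  position fzero = p
  position (fsuc fzero) = q
  position (fsuc (fsuc i)) = suc (K + toℕ i)
  position-< : ∀ {i i′} → toℕ i < toℕ i′ → position i < position i′
  position-< {fzero} {fsuc fzero} _ = p<q
  position-< {fsuc fzero} {fsuc fzero} (s≤s ())
  position-< {fzero} {fsuc (fsuc _)} _ = <-≤-trans p<q (≤-trans q≤K (≤-trans (m≤m+n K _) (n≤1+n _)))
  position-< {fsuc fzero} {fsuc (fsuc _)} _ = s≤s (≤-trans q≤K (m≤m+n K _))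
  position-< {fsuc (fsuc i)} {fsuc (fsuc i′)} (s≤s (s≤s i<i′)) = s≤s (+-monoʳ-< K i<i′)
  right-of-K≤n : ∀ (i : Fin (n ∸ K)) → suc (K + toℕ i) ≤ n
  right-of-K≤n i = ≤-trans (≤-reflexive (sym (+-suc K (toℕ i))))
                           (≤-trans (+-monoʳ-≤ K (toℕ<n i)) (≤-reflexive (m+[n∸m]≡n K≤n)))
  position-inRange : ∀ i → InRange n (position i)
  position-inRange fzero = 1≤p , ≤-trans (<⇒≤ p<q) (≤-trans q≤K K≤n)
  position-inRange (fsuc fzero) = ≤-trans 1≤p (<⇒≤ p<q) , ≤-trans q≤K K≤n
  position-inRange (fsuc (fsuc i)) = s≤s z≤n , right-of-K≤n i
  high : ∀ i → K ≤ f (position i)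
  high fzero = K≤fp
  high (fsuc fzero) = K≤fq
  high (fsuc (fsuc i)) =
    ≮⇒≥ (λ low → none (_ , position-inRange (fsuc (fsuc i)) , s≤s (m≤m+n K _) , low))

maxAbove-spec : ∀ f b hi →
  (maxAbove f b 1 hi ≡ 0 × (∀ {x} → InRange hi x → f x ≤ b)) ⊎
  (InRange hi (maxAbove f b 1 hi) × b < f (maxAbove f b 1 hi))
maxAbove-spec f b zero = inj₁ (refl , λ (1≤x , x≤0) → ⊥-elim (<-irrefl refl (≤-trans 1≤x x≤0)))
maxAbove-spec f b (suc hi) with b <? f (suc hi)
... | yes b<f rewrite <⇒<ᵇ-true b<f = inj₂ ((s≤s z≤n , ≤-refl) , b<f)
... | no b≮f rewrite ≮⇒<ᵇ-false b≮f with maxAbove-spec f b hi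
...   | inj₂ ((1≤t , t≤hi) , b<ft) = inj₂ ((1≤t , m≤n⇒m≤1+n t≤hi) , b<ft)
...   | inj₁ (≡0 , none) = inj₁ (≡0 , below)
  where
  below : ∀ {x} → InRange (suc hi) x → f x ≤ b
  below {x} (1≤x , x≤1+hi) with x ≟ suc hi
  ... | yes refl = ≮⇒≥ b≮f
  ... | no x≢1+hi = none (1≤x , ≤-pred (≤∧≢⇒< x≤1+hi x≢1+hi))

minBelow-spec : ∀ f b lo len →
  (∀ {x} → lo ≤ x → x < lo + len → b ≤ f x) ⊎
  (lo ≤ minBelow f b lo len × minBelow f b lo len < lo + len × f (minBelow f b lo len) < b)
minBelow-spec f b lo zero =
  inj₁ (λ lo≤x x<lo+0 → ⊥-elim (<⇒≱ x<lo+0 (subst (_≤ _) (sym (+-identityʳ lo)) lo≤x)))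
minBelow-spec f b lo (suc len) with f lo <? b
... | yes flo<b rewrite <⇒<ᵇ-true flo<b = inj₂ (≤-refl , m<m+n lo (s≤s z≤n) , flo<b)
... | no flo≮b rewrite ≮⇒<ᵇ-false flo≮b with minBelow-spec f b (suc lo) len
...   | inj₂ (lo<t , t<end , ft<b) =
  inj₂ (<⇒≤ lo<t , subst (minBelow f b (suc lo) len <_) (sym (+-suc lo len)) t<end , ft<b)
...   | inj₁ none = inj₁ above
  where
  above : ∀ {x} → lo ≤ x → x < lo + suc len → b ≤ f x
  above {x} lo≤x x<end with lo ≟ x
  ... | yes refl = ≮⇒≥ flo≮b
  ... | no lo≢x = none (≤∧≢⇒< lo≤x lo≢x) (subst (x <_) (+-suc lo len) x<end)

module Angle {n} (w : Permutation′ n) (k : ℕ) (k+2≤n : suc (suc k) ≤ n) where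
  K : ℕ
  K = suc k
  W : ℕ → ℕ
  W = fun w
  m : ℕ
  m = funInv w K
  a : ℕ
  a = W K
  u : ℕ → ℕ
  u = wAngle w k

  swaps : Bool
  swaps = ((K <ᵇ m) ∧ (K <ᵇ a)) ∨ ((m <ᵇ K) ∧ (a <ᵇ K))

  t : ℕ
  t = if K <ᵇ m then maxAbove W K 1 k else minBelow W K (suc K) (n ∸ K)

  u-fixed : m ≡ K → ∀ i → u i ≡ W i
  u-fixed m≡K i rewrite ≡⇒≡ᵇ-true m≡K = refl

  u-swap-m : m ≢ K → swaps ≡ true → u m ≡ a
  u-swap-m m≢K swap rewrite ≢⇒≡ᵇ-false m≢K | swap | ≡ᵇ-refl m = refl

  u-swap-other : m ≢ K → swaps ≡ true → ∀ {i} → i ≢ K → i ≢ m → u i ≡ W i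
  u-swap-other m≢K swap {i} i≢K i≢m
    rewrite ≢⇒≡ᵇ-false m≢K | swap | ≢⇒≡ᵇ-false i≢K | ≢⇒≡ᵇ-false i≢m = refl

  u-cycle-t : m ≢ K → swaps ≡ false → t ≢ K → u t ≡ a
  u-cycle-t m≢K cycle t≢K rewrite ≢⇒≡ᵇ-false m≢K | cycle | ≢⇒≡ᵇ-false t≢K | ≡ᵇ-refl t = refl

  u-cycle-m : m ≢ K → swaps ≡ false → m ≢ t → u m ≡ W t
  u-cycle-m m≢K cycle m≢t rewrite ≢⇒≡ᵇ-false m≢K | cycle | ≢⇒≡ᵇ-false m≢t | ≡ᵇ-refl m = refl

  u-cycle-other : m ≢ K → swaps ≡ false → ∀ {i} → i ≢ K → i ≢ t → i ≢ m → u i ≡ W i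
  u-cycle-other m≢K cycle {i} i≢K i≢t i≢m
    rewrite ≢⇒≡ᵇ-false m≢K | cycle | ≢⇒≡ᵇ-false i≢K | ≢⇒≡ᵇ-false i≢t | ≢⇒≡ᵇ-false i≢m = refl

  swaps-true : (K < m × K < a) ⊎ (m < K × a < K) → swaps ≡ true
  swaps-true (inj₁ (K<m , K<a)) rewrite <⇒<ᵇ-true K<m | <⇒<ᵇ-true K<a = refl
  swaps-true (inj₂ (m<K , a<K))
    rewrite ≮⇒<ᵇ-false (<⇒≯ m<K) | <⇒<ᵇ-true m<K | <⇒<ᵇ-true a<K = refl

  swaps-false : (K < m × a < K) ⊎ (m < K × K < a) → swaps ≡ false
  swaps-false (inj₁ (K<m , a<K))
    rewrite <⇒<ᵇ-true K<m | ≮⇒<ᵇ-false (<⇒≯ a<K) | ≮⇒<ᵇ-false (<⇒≯ K<m) = refl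
  swaps-false (inj₂ (m<K , K<a))
    rewrite ≮⇒<ᵇ-false (<⇒≯ m<K) | <⇒<ᵇ-true m<K | ≮⇒<ᵇ-false (<⇒≯ K<a) = refl

  K≤n : K ≤ n
  K≤n = ≤-trans (n≤1+n K) k+2≤n

  ≤n⇒<end : ∀ {j} → j ≤ n → j < suc K + (n ∸ K)
  ≤n⇒<end {j} j≤n = subst (j <_) (sym (cong suc (m+[n∸m]≡n K≤n))) (s≤s j≤n)

  <end⇒≤n : ∀ {j} → j < suc K + (n ∸ K) → j ≤ n
  <end⇒≤n {j} j<end = ≤-pred (subst (j <_) (cong suc (m+[n∸m]≡n K≤n)) j<end)

  t-spec-right : K < m → (t ≡ 0 × (∀ {x} → InRange k x → W x ≤ K)) ⊎ (InRange k t × K < W t)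
  t-spec-right K<m rewrite <⇒<ᵇ-true K<m = maxAbove-spec W K k

  t-spec-left : m < K → (∀ {x} → K < x → x ≤ n → K ≤ W x) ⊎ (K < t × t ≤ n × W t < K)
  t-spec-left m<K rewrite ≮⇒<ᵇ-false (<⇒≯ m<K) with minBelow-spec W K (suc K) (n ∸ K)
  ... | inj₁ none = inj₁ (λ K<x x≤n → none K<x (≤n⇒<end x≤n))
  ... | inj₂ (K<t , t<end , Wt<K) = inj₂ (K<t , <end⇒≤n t<end , Wt<K)

  W-m : W m ≡ K
  W-m = fun-funInv w (s≤s z≤n , K≤n)

  m-inRange : InRange n m
  m-inRange = fun-range (flip w) (s≤s z≤n , K≤n)

  ≡K⇒≡m : ∀ {x} → InRange n x → W x ≡ K → x ≡ m
  ≡K⇒≡m x-inRange Wx≡K = fun-injective w x-inRange m-inRange (trans Wx≡K (sym W-m))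

  ≢K⇒≢m : ∀ {x} → W x ≢ K → x ≢ m
  ≢K⇒≢m Wx≢K refl = Wx≢K W-m

  m≢K⇒a≢K : m ≢ K → a ≢ K
  m≢K⇒a≢K m≢K a≡K = m≢K (sym (≡K⇒≡m (s≤s z≤n , K≤n) a≡K))

  lowRight : TwoAtLeast W K → ∃[ j ] (K < j × j ≤ n × W j < K)
  lowRight = twoAtLeast⇒lowRight (proj₂ ∘ fun-range w) (fun-injective w) K≤n

  twoAtLeast : ∀ {p q} → p ≢ q → InRange K p → InRange K q → K ≤ W p → K ≤ W q → TwoAtLeast W K
  twoAtLeast {p} {q} p≢q (1≤p , p≤K) (1≤q , q≤K) K≤Wp K≤Wq with <-cmp p q
  ... | tri< p<q _ _ = p , q , 1≤p , p<q , q≤K , K≤Wp , K≤Wq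
  ... | tri≈ _ p≡q _ = ⊥-elim (p≢q p≡q)
  ... | tri> _ _ q<p = q , p , 1≤q , q<p , p≤K , K≤Wq , K≤Wp

  has321 : ∀ {i j} → 1 ≤ i → i < K → K < j → j ≤ n → K < W i → W j < K →
    u i ≡ W i → u j ≡ W j → Has321At n u K
  has321 1≤i i<K K<j j≤n K<Wi Wj<K ui≡Wi uj≡Wj =
    _ , _ , 1≤i , i<K , K<j , j≤n , subst (K <_) (sym ui≡Wi) K<Wi , subst (_< K) (sym uj≡Wj) Wj<K

  fixed-case : m ≡ K → Above321At W K ⇔ Has321At n u K
  fixed-case m≡K = mk⇔ to from
    where
    to : Above321At W K → Has321At n u K
    to ((i , 1≤i , i<K , K<Wi) , two) with lowRight two
    ... | j , K<j , j≤n , Wj<K = has321 1≤i i<K K<j j≤n K<Wi Wj<K (u-fixed m≡K i) (u-fixed m≡K j)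
    from : Has321At n u K → Above321At W K
    from (i , _ , 1≤i , i<K , _ , _ , K<ui , _) =
      (i , 1≤i , i<K , K<Wi) ,
      twoAtLeast (<⇒≢ i<K) (1≤i , <⇒≤ i<K) (s≤s z≤n , ≤-refl) (<⇒≤ K<Wi)
                 (≤-reflexive (sym (subst (λ x → W x ≡ K) m≡K W-m)))
      where
      K<Wi : K < W i
      K<Wi = subst (K <_) (u-fixed m≡K i) K<ui

  module Swap (m≢K : m ≢ K) (sides : (K < m × K < a) ⊎ (m < K × a < K)) where
    u≡W : ∀ {i} → i ≢ K → i ≢ m → u i ≡ W i
    u≡W = u-swap-other m≢K (swaps-true sides)

    i≢m : ∀ {i} → (K < m × K < a) ⊎ (m < K × a < K) → i < K → K < u i → i ≢ m
    i≢m (inj₁ (K<m , _)) i<K _ refl = <-asym K<m i<K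
    i≢m (inj₂ (_ , a<K)) _ K<ui refl = <-asym a<K (subst (K <_) (u-swap-m m≢K (swaps-true sides)) K<ui)

    to : Above321At W K → Has321At n u K
    to ((i , 1≤i , i<K , K<Wi) , two) with lowRight two
    ... | j , K<j , j≤n , Wj<K = has321 1≤i i<K K<j j≤n K<Wi Wj<K
      (u≡W (<⇒≢ i<K) (≢K⇒≢m (>⇒≢ K<Wi))) (u≡W (>⇒≢ K<j) (≢K⇒≢m (<⇒≢ Wj<K)))

    from : Has321At n u K → Above321At W K
    from (i , _ , 1≤i , i<K , _ , _ , K<ui , _) = (i , 1≤i , i<K , K<Wi) , second sides
      where
      K<Wi : K < W i
      K<Wi = subst (K <_) (u≡W (<⇒≢ i<K) (i≢m sides i<K K<ui)) K<ui
      second : (K < m × K < a) ⊎ (m < K × a < K) → TwoAtLeast W K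
      second (inj₁ (_ , K<a)) =
        twoAtLeast (<⇒≢ i<K) (1≤i , <⇒≤ i<K) (s≤s z≤n , ≤-refl) (<⇒≤ K<Wi) (<⇒≤ K<a)
      second (inj₂ (m<K , _)) =
        twoAtLeast (i≢m sides i<K K<ui) (1≤i , <⇒≤ i<K) (proj₁ m-inRange , <⇒≤ m<K)
                   (<⇒≤ K<Wi) (≤-reflexive (sym W-m))

    criterion : Above321At W K ⇔ Has321At n u K
    criterion = mk⇔ to from

  module CycleRight (m≢K : m ≢ K) (K<m : K < m) (a<K : a < K) where
    u≡W : ∀ {i} → i ≢ K → i ≢ t → i ≢ m → u i ≡ W i
    u≡W = u-cycle-other m≢K (swaps-false (inj₁ (K<m , a<K)))

    i≢m : ∀ {i} → i < K → i ≢ m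
    i≢m i<K = <⇒≢ (<-trans i<K K<m)

    without-t : t ≡ 0 → (∀ {x} → InRange k x → W x ≤ K) → Above321At W K ⇔ Has321At n u K
    without-t t≡0 none = mk⇔
      (λ ((i , 1≤i , i<K , K<Wi) , _) → ⊥-elim (<⇒≱ K<Wi (none (1≤i , ≤-pred i<K))))
      (λ (i , _ , 1≤i , i<K , _ , _ , K<ui , _) →
        ⊥-elim (<⇒≱ (subst (K <_) (u≡W (<⇒≢ i<K) (λ i≡t → >⇒≢ 1≤i (trans i≡t t≡0)) (i≢m i<K)) K<ui)
                    (none (1≤i , ≤-pred i<K))))

    module _ (t-inRange : InRange k t) (K<Wt : K < W t) where
      other-than-t : TwoAtLeast W K → ∃[ i ] (1 ≤ i × i < K × i ≢ t × K ≤ W i)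
      other-than-t (p , q , 1≤p , p<q , q≤K , K≤Wp , K≤Wq) with p ≟ t
      ... | yes refl = q , ≤-trans 1≤p (<⇒≤ p<q) , q<K , >⇒≢ p<q , K≤Wq
        where
        q<K : q < K
        q<K = ≤∧≢⇒< q≤K (λ { refl → <⇒≱ a<K K≤Wq })
      ... | no p≢t = p , 1≤p , <-≤-trans p<q q≤K , p≢t , K≤Wp

      to : Above321At W K → Has321At n u K
      to (_ , two) with other-than-t two | lowRight two
      ... | i , 1≤i , i<K , i≢t , K≤Wi | j , K<j , j≤n , Wj<K = has321 1≤i i<K K<j j≤n K<Wi Wj<K
        (u≡W (<⇒≢ i<K) i≢t (i≢m i<K))
        (u≡W (>⇒≢ K<j) (>⇒≢ (<-trans (s≤s (proj₂ t-inRange)) K<j)) (≢K⇒≢m (<⇒≢ Wj<K)))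
        where
        K<Wi : K < W i
        K<Wi = ≤∧≢⇒< K≤Wi (λ K≡Wi → i≢m i<K (≡K⇒≡m (1≤i , ≤-trans (<⇒≤ i<K) K≤n) (sym K≡Wi)))

      from : Has321At n u K → Above321At W K
      from (i , _ , 1≤i , i<K , _ , _ , K<ui , _) =
        (i , 1≤i , i<K , K<Wi) ,
        twoAtLeast i≢t (1≤i , <⇒≤ i<K) (proj₁ t-inRange , m≤n⇒m≤1+n (proj₂ t-inRange)) (<⇒≤ K<Wi) (<⇒≤ K<Wt)
        where
        i≢t : i ≢ t
        i≢t refl = <-asym a<K (subst (K <_) (u-cycle-t m≢K (swaps-false (inj₁ (K<m , a<K))) (<⇒≢ i<K)) K<ui)
        K<Wi : K < W i
        K<Wi = subst (K <_) (u≡W (<⇒≢ i<K) i≢t (i≢m i<K)) K<ui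

    criterion : Above321At W K ⇔ Has321At n u K
    criterion with t-spec-right K<m
    ... | inj₁ (t≡0 , none) = without-t t≡0 none
    ... | inj₂ (t-inRange , K<Wt) = mk⇔ (to t-inRange K<Wt) (from t-inRange K<Wt)

  module CycleLeft (m≢K : m ≢ K) (m<K : m < K) (K<a : K < a) where
    cycle : swaps ≡ false
    cycle = swaps-false (inj₂ (m<K , K<a))

    m-and-K : TwoAtLeast W K
    m-and-K = twoAtLeast (<⇒≢ m<K) (proj₁ m-inRange , <⇒≤ m<K) (s≤s z≤n , ≤-refl) (≤-reflexive (sym W-m)) (<⇒≤ K<a)

    module _ (K<t : K < t) (t≤n : t ≤ n) (Wt<K : W t < K) where
      -- W′ differs from u only at K and t, and W′ t = K, so its small value right of K is not at t.
      W′ : ℕ → ℕ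
      W′ = W ∘ τ t m

      t-inRange : InRange n t
      t-inRange = <-≤-trans (s≤s z≤n) K<t , t≤n

      W′-injective : InjectiveOn n W′
      W′-injective {x} {y} x-inRange y-inRange eq = begin
        x                   ≡⟨ τ-involutive t m x ⟨
        τ t m (τ t m x)     ≡⟨ cong (τ t m) (fun-injective w (τ-inRange t-inRange m-inRange x-inRange)
                                                           (τ-inRange t-inRange m-inRange y-inRange) eq) ⟩
        τ t m (τ t m y)     ≡⟨ τ-involutive t m y ⟩
        y                   ∎
        where open ≡-Reasoning

      W′-lowRight : ∀ {i} → 1 ≤ i → i < K → K < W i → ∃[ j ] (K < j × j ≤ n × W′ j < K)
      W′-lowRight {i} 1≤i i<K K<Wi =
        twoAtLeast⇒lowRight (λ x-inRange → proj₂ (fun-range w (τ-inRange t-inRange m-inRange x-inRange)))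
          W′-injective K≤n
          (i , K , 1≤i , i<K , ≤-refl ,
           subst (K ≤_) (cong W (sym (τ-other t m (<⇒≢ (<-trans i<K K<t)) (≢K⇒≢m (>⇒≢ K<Wi))))) (<⇒≤ K<Wi) ,
           subst (K ≤_) (cong W (sym (τ-other t m (<⇒≢ K<t) (>⇒≢ m<K)))) (<⇒≤ K<a))

      to : Above321At W K → Has321At n u K
      to ((i , 1≤i , i<K , K<Wi) , _) with W′-lowRight 1≤i i<K K<Wi
      ... | j , K<j , j≤n , W′j<K = has321 1≤i i<K K<j j≤n K<Wi Wj<K
        (u-cycle-other m≢K cycle (<⇒≢ i<K) (<⇒≢ (<-trans i<K K<t)) (≢K⇒≢m (>⇒≢ K<Wi)))
        (u-cycle-other m≢K cycle (>⇒≢ K<j) j≢t j≢m)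
        where
        j≢m : j ≢ m
        j≢m = >⇒≢ (<-trans m<K K<j)
        j≢t : j ≢ t
        j≢t refl = <-irrefl (trans (cong W (τ-left t m)) W-m) W′j<K
        Wj<K : W j < K
        Wj<K = subst (_< K) (cong W (τ-other t m j≢t j≢m)) W′j<K

      from : Has321At n u K → Above321At W K
      from (i , _ , 1≤i , i<K , _ , _ , K<ui , _) with i ≟ m
      ... | yes refl = ⊥-elim (<-asym Wt<K (subst (K <_) (u-cycle-m m≢K cycle (<⇒≢ (<-trans m<K K<t))) K<ui))
      ... | no i≢m =
        (i , 1≤i , i<K , subst (K <_) (u-cycle-other m≢K cycle (<⇒≢ i<K) (<⇒≢ (<-trans i<K K<t)) i≢m) K<ui) ,
        m-and-K

    criterion : Above321At W K ⇔ Has321At n u K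
    criterion with t-spec-left m<K | lowRight m-and-K
    ... | inj₁ none | j , K<j , j≤n , Wj<K = ⊥-elim (<⇒≱ Wj<K (none K<j j≤n))
    ... | inj₂ (K<t , t≤n , Wt<K) | _ = mk⇔ (to K<t t≤n Wt<K) (from K<t t≤n Wt<K)

  above321⇔has321 : Above321At W K ⇔ Has321At n u K
  above321⇔has321 with m ≟ K
  ... | yes m≡K = fixed-case m≡K
  ... | no m≢K with <-cmp K m | <-cmp K a
  ...   | tri< K<m _ _ | tri< K<a _ _ = Swap.criterion m≢K (inj₁ (K<m , K<a))
  ...   | tri> _ _ m<K | tri> _ _ a<K = Swap.criterion m≢K (inj₂ (m<K , a<K))
  ...   | tri< K<m _ _ | tri> _ _ a<K = CycleRight.criterion m≢K K<m a<K
  ...   | tri> _ _ m<K | tri< K<a _ _ = CycleLeft.criterion m≢K m<K K<a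
  ...   | tri≈ _ K≡m _ | _ = ⊥-elim (m≢K (sym K≡m))
  ...   | _ | tri≈ _ K≡a _ = ⊥-elim (m≢K⇒a≢K m≢K (sym K≡a))

theorem3p3 : (n : ℕ) (w : Permutation′ n) (k : ℕ) → 1 ≤ k → k ≤ n ∸ 2 →
    Interlaced w k ⇔ Has321At n (wAngle w k) (suc k)
theorem3p3 (suc (suc n)) w (suc k) _ k≤n =
  ⇔-trans (interlaced⇔above321 w (suc k) k+2≤n)
          (Angle.above321⇔has321 w (suc k) k+2≤n)
  where
  k+2≤n : suc (suc (suc k)) ≤ suc (suc n)
  k+2≤n = s≤s (s≤s k≤n)
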